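{- Let $G$ be a finite abelian group with identity $e$ and let $U\subseteq G\setminus\{e\}$ be symmetric. If $G$ has an element $x$ of order $2$ with $x\notin U$, then there exist symmetric subsets $S,T\subseteq G\setminus\{e\}$ with $A(G;U)=A(G;S)A(G;T)$.
   Context: A subset $X$ is symmetric if $X^{ -1}=X$. Fix an enumeration $G=\{g_1,\dots,g_n\}$; for $X\subseteq G$, $A(G;X)$ is the $n\times n$ matrix with $(i,j)$ entry $1$ if $g_i^{ -1}g_j\in X$ and $0$ otherwise. -}

module Defs where

open import Data.Nat using (ℕ; _+_; _*_)
open import Data.Fin using (Fin)
open import Data.Fin.Subset using (Subset; _∈_; _∉_)
open import Data.Fin.Subset.Properties using (_∈?_)
open import Data.Vec using (sum; tabulate)
open import Data.Product using (_×_)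
open import Relation.Nullary using (¬_; does)
open import Data.Bool using (if_then_else_)
open import Relation.Binary.PropositionalEquality using (_≡_)
open import Function.Bundles using (_⇔_)

-- A finite group of order n is presented on the carrier Fin n: the element
-- g_i of the paper's enumeration is the index i.

module _ {n : ℕ} (_∙_ : Fin n → Fin n → Fin n) (ε : Fin n) (_⁻¹ : Fin n → Fin n) where

  Symmetric : Subset n → Set
  Symmetric X = ∀ g → (g ∈ X) ⇔ ((g ⁻¹) ∈ X)

  HasOrder2 : Fin n → Set
  HasOrder2 x = ¬ (x ≡ ε) × (x ∙ x ≡ ε)

  A : Subset n → Fin n → Fin n → ℕ
  A X i j = if does (((i ⁻¹) ∙ j) ∈? X) then 1 else 0

_⊗_ : {n : ℕ} → (Fin n → Fin n → ℕ) → (Fin n → Fin n → ℕ) → Fin n → Fin n → ℕ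
(M ⊗ N) i j = sum (tabulate (λ k → M i k * N k j))

{-# OPTIONS --safe #-}
-- Right multiplication by A(G;{t}) shifts columns: (M A(G;{t}))(i,j) = M(i, j t⁻¹).
-- Hence A(G;U) = A(G;Ut⁻¹) A(G;{t}) in any group and for any t. Take t = x:
-- since x = x⁻¹ and G is abelian, Ux⁻¹ = Ux and {x} are symmetric; {x} avoids e
-- because x ≠ e, and Ux avoids e because x ∉ U.
module Submission where

open import Defs
open import Algebra.Core using (Op₁; Op₂)
open import Algebra.Bundles using (Group; AbelianGroup)
open import Algebra.Structures using (IsGroup; IsAbelianGroup)
import Algebra.Properties.Group as GroupProperties
import Algebra.Properties.AbelianGroup as AbelianGroupProperties
open import Data.Bool using (true; if_then_else_)
open import Data.Fin using (Fin; zero; suc)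
open import Data.Fin.Properties using (suc-injective)
open import Data.Fin.Subset using (Subset; _∈_; _∉_; ⁅_⁆)
open import Data.Fin.Subset.Properties using (_∈?_; x∈⁅y⁆⇒x≡y; x∈⁅y⁆⇔x≡y; x≢y⇒x∉⁅y⁆)
open import Data.Nat using (ℕ; zero; suc; _+_; _*_)
open import Data.Nat.Properties using (+-identityʳ; *-identityʳ; *-zeroʳ)
open import Data.Product using (Σ; _×_; _,_)
open import Data.Vec using (sum; tabulate)
open import Data.Vec.Properties using (lookup∘tabulate; []=⇒lookup; lookup⇒[]=)
open import Function using (_∘_)
open import Function.Bundles using (_⇔_; mk⇔; Equivalence)
open import Function.Properties.Equivalence using (⇔-setoid)
open import Level using (0ℓ)
open import Relation.Nullary using (Dec; does; yes; no)
open import Relation.Nullary.Decidable using (dec-true; dec-false; does-⇔)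
open import Relation.Binary.PropositionalEquality
  using (_≡_; _≢_; refl; sym; trans; cong; cong₂; subst; module ≡-Reasoning)
import Relation.Binary.Reasoning.Setoid as SetoidReasoning

sum-tabulate-zero : ∀ {n} (f : Fin n → ℕ) → (∀ k → f k ≡ 0) → sum (tabulate f) ≡ 0
sum-tabulate-zero {zero}  f f≡0 = refl
sum-tabulate-zero {suc n} f f≡0 = cong₂ _+_ (f≡0 zero) (sum-tabulate-zero (f ∘ suc) (f≡0 ∘ suc))

sum-tabulate-single : ∀ {n} (f : Fin n → ℕ) (k : Fin n) →
                      (∀ l → l ≢ k → f l ≡ 0) → sum (tabulate f) ≡ f k
sum-tabulate-single f zero f≡0 =
  trans (cong (f zero +_) (sum-tabulate-zero (f ∘ suc) (λ l → f≡0 (suc l) λ ())))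
        (+-identityʳ (f zero))
sum-tabulate-single f (suc k) f≡0 =
  cong₂ _+_ (f≡0 zero λ ())
            (sum-tabulate-single (f ∘ suc) k (λ l l≢k → f≡0 (suc l) (l≢k ∘ suc-injective)))

preimage : ∀ {m n} → (Fin m → Fin n) → Subset n → Subset m
preimage f U = tabulate (λ g → does (f g ∈? U))

∈-preimage : ∀ {m n} (f : Fin m → Fin n) {U : Subset n} {g : Fin m} →
             g ∈ preimage f U ⇔ f g ∈ U
∈-preimage f {U} {g} = mk⇔
  (λ g∈f⁻¹U → does≡true⇒ (f g ∈? U) (trans (sym (lookup∘tabulate _ g)) ([]=⇒lookup g∈f⁻¹U)))
  (λ fg∈U → lookup⇒[]= g _ (trans (lookup∘tabulate _ g) (dec-true (f g ∈? U) fg∈U)))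
  where
  does≡true⇒ : ∀ {P : Set} (p? : Dec P) → does p? ≡ true → P
  does≡true⇒ (yes p) _ = p
  does≡true⇒ (no _) ()

module Cayley {n : ℕ} {_∙_ : Op₂ (Fin n)} {ε : Fin n} {_⁻¹ : Op₁ (Fin n)}
              (isGroup : IsGroup _≡_ _∙_ ε _⁻¹) where

  private
    group : Group 0ℓ 0ℓ
    group = record { isGroup = isGroup }

  open IsGroup isGroup using (_\\_; _//_; assoc; identityˡ)
  open GroupProperties group
    using (\\-leftDividesˡ; //-rightDividesˡ; x≈z//y; y≈x\\z; inverseˡ-unique; ⁻¹-involutive)

  Adj : Subset n → Fin n → Fin n → ℕ
  Adj = A _∙_ ε _⁻¹

  Adj-cong : ∀ {X Y i j k l} → (i \\ j ∈ X ⇔ k \\ l ∈ Y) → Adj X i j ≡ Adj Y k l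
  Adj-cong i\\j∈X⇔k\\l∈Y = cong (λ b → if b then 1 else 0) (does-⇔ i\\j∈X⇔k\\l∈Y (_ ∈? _) (_ ∈? _))

  Adj-∈ : ∀ {X i j} → i \\ j ∈ X → Adj X i j ≡ 1
  Adj-∈ i\\j∈X = cong (λ b → if b then 1 else 0) (dec-true (_ ∈? _) i\\j∈X)

  Adj-∉ : ∀ {X i j} → i \\ j ∉ X → Adj X i j ≡ 0
  Adj-∉ i\\j∉X = cong (λ b → if b then 1 else 0) (dec-false (_ ∈? _) i\\j∉X)

  Adj-⊗-⁅⁆ : ∀ X t i j → (Adj X ⊗ Adj ⁅ t ⁆) i j ≡ Adj X i (j // t)
  Adj-⊗-⁅⁆ X t i j = begin
    sum (tabulate (λ k → Adj X i k * Adj ⁅ t ⁆ k j)) ≡⟨ sum-tabulate-single _ (j // t) off-diagonal ⟩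
    Adj X i (j // t) * Adj ⁅ t ⁆ (j // t) j         ≡⟨ cong (Adj X i (j // t) *_) diagonal ⟩
    Adj X i (j // t) * 1                            ≡⟨ *-identityʳ _ ⟩
    Adj X i (j // t)                                ∎
    where
    open ≡-Reasoning

    k\\j≡t⇒k≡j//t : ∀ {k} → k \\ j ≡ t → k ≡ j // t
    k\\j≡t⇒k≡j//t {k} k\\j≡t = x≈z//y k t j (subst (λ s → k ∙ s ≡ j) k\\j≡t (\\-leftDividesˡ k j))

    off-diagonal : ∀ k → k ≢ j // t → Adj X i k * Adj ⁅ t ⁆ k j ≡ 0
    off-diagonal k k≢j//t = trans
      (cong (Adj X i k *_) (Adj-∉ (k≢j//t ∘ k\\j≡t⇒k≡j//t ∘ x∈⁅y⁆⇒x≡y t)))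
      (*-zeroʳ (Adj X i k))

    diagonal : Adj ⁅ t ⁆ (j // t) j ≡ 1
    diagonal = Adj-∈ (Equivalence.from x∈⁅y⁆⇔x≡y (sym (y≈x\\z (j // t) t j (//-rightDividesˡ t j))))

  Adj-preimage-∙ʳ : ∀ U t i j → Adj (preimage (_∙ t) U) i (j // t) ≡ Adj U i j
  Adj-preimage-∙ʳ U t i j =
    Adj-cong (subst (λ s → i \\ (j // t) ∈ preimage (_∙ t) U ⇔ s ∈ U)
                    i\\[j//t]∙t≡i\\j (∈-preimage (_∙ t)))
    where
    i\\[j//t]∙t≡i\\j : (i \\ (j // t)) ∙ t ≡ i \\ j
    i\\[j//t]∙t≡i\\j = trans (assoc (i ⁻¹) (j // t) t) (cong ((i ⁻¹) ∙_) (//-rightDividesˡ t j))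

  -- preimage (_∙ t) U is the translate U t⁻¹.
  Adj-factor-∙ʳ : ∀ U t i j → Adj U i j ≡ (Adj (preimage (_∙ t) U) ⊗ Adj ⁅ t ⁆) i j
  Adj-factor-∙ʳ U t i j = sym (trans (Adj-⊗-⁅⁆ (preimage (_∙ t) U) t i j) (Adj-preimage-∙ʳ U t i j))

  x∙x≡ε⇒x⁻¹≡x : ∀ {x} → x ∙ x ≡ ε → x ⁻¹ ≡ x
  x∙x≡ε⇒x⁻¹≡x {x} x∙x≡ε = sym (inverseˡ-unique x x x∙x≡ε)

  ⁅⁆-symmetric : ∀ {t} → t ⁻¹ ≡ t → Symmetric _∙_ ε _⁻¹ ⁅ t ⁆
  ⁅⁆-symmetric {t} t⁻¹≡t g = mk⇔
    (λ g∈⁅t⁆ → Equivalence.from x∈⁅y⁆⇔x≡y (trans (cong _⁻¹ (x∈⁅y⁆⇒x≡y t g∈⁅t⁆)) t⁻¹≡t))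
    (λ g⁻¹∈⁅t⁆ → Equivalence.from x∈⁅y⁆⇔x≡y
      (trans (sym (⁻¹-involutive g)) (trans (cong _⁻¹ (x∈⁅y⁆⇒x≡y t g⁻¹∈⁅t⁆)) t⁻¹≡t)))

  ε∉preimage-∙ʳ : ∀ {U t} → t ∉ U → ε ∉ preimage (_∙ t) U
  ε∉preimage-∙ʳ {U} {t} t∉U ε∈ =
    t∉U (subst (_∈ U) (identityˡ t) (Equivalence.to (∈-preimage (_∙ t)) ε∈))

preimage-∙ʳ-symmetric : ∀ {n} {_∙_ : Op₂ (Fin n)} {ε : Fin n} {_⁻¹ : Op₁ (Fin n)} →
                        IsAbelianGroup _≡_ _∙_ ε _⁻¹ → ∀ {U t} → t ⁻¹ ≡ t →
                        Symmetric _∙_ ε _⁻¹ U → Symmetric _∙_ ε _⁻¹ (preimage (_∙ t) U)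
preimage-∙ʳ-symmetric {_∙_ = _∙_} {_⁻¹ = _⁻¹} isAbelianGroup {U} {t} t⁻¹≡t symU g = begin
  g ∈ preimage (_∙ t) U      ≈⟨ ∈-preimage (_∙ t) ⟩
  (g ∙ t) ∈ U                ≈⟨ symU (g ∙ t) ⟩
  ((g ∙ t) ⁻¹) ∈ U           ≡⟨ cong (_∈ U) [g∙t]⁻¹≡g⁻¹∙t ⟩
  ((g ⁻¹) ∙ t) ∈ U           ≈⟨ ∈-preimage (_∙ t) ⟨
  (g ⁻¹) ∈ preimage (_∙ t) U ∎
  where
  open SetoidReasoning (⇔-setoid 0ℓ)

  abelianGroup : AbelianGroup 0ℓ 0ℓ
  abelianGroup = record { isAbelianGroup = isAbelianGroup }

  open AbelianGroupProperties abelianGroup using (⁻¹-∙-comm)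

  [g∙t]⁻¹≡g⁻¹∙t : (g ∙ t) ⁻¹ ≡ (g ⁻¹) ∙ t
  [g∙t]⁻¹≡g⁻¹∙t = trans (sym (⁻¹-∙-comm g t)) (cong ((g ⁻¹) ∙_) t⁻¹≡t)

mainTheorem9 : (n : ℕ) (_∙_ : Fin n → Fin n → Fin n) (ε : Fin n) (_⁻¹ : Fin n → Fin n)
    → IsAbelianGroup _≡_ _∙_ ε _⁻¹
    → (U : Subset n) → ε ∉ U → Symmetric _∙_ ε _⁻¹ U
    → (Σ (Fin n) λ x → HasOrder2 _∙_ ε _⁻¹ x × x ∉ U)
    → Σ (Subset n) λ S → Σ (Subset n) λ T →
        (ε ∉ S) × Symmetric _∙_ ε _⁻¹ S × (ε ∉ T) × Symmetric _∙_ ε _⁻¹ T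
        × (∀ i j → A _∙_ ε _⁻¹ U i j ≡ (A _∙_ ε _⁻¹ S ⊗ A _∙_ ε _⁻¹ T) i j)
mainTheorem9 n _∙_ ε _⁻¹ isAbelianGroup U _ symU (x , (x≢ε , x∙x≡ε) , x∉U) =
  preimage (_∙ x) U , ⁅ x ⁆ ,
  ε∉preimage-∙ʳ x∉U , preimage-∙ʳ-symmetric isAbelianGroup x⁻¹≡x symU ,
  x≢y⇒x∉⁅y⁆ (x≢ε ∘ sym) , ⁅⁆-symmetric x⁻¹≡x ,
  Adj-factor-∙ʳ U x
  where
  open Cayley (IsAbelianGroup.isGroup isAbelianGroup)

  x⁻¹≡x : x ⁻¹ ≡ x
  x⁻¹≡x = x∙x≡ε⇒x⁻¹≡x x∙x≡ε
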